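{- Let $p$ be a prime, $m\ge1$ and $\sigma:\mathcal A_m\to\mathcal A_m^*$ a $p$-uniform morphism. Then for every $n\geq 1$, $$M_{\sigma^n}(T)=M_\sigma(T^{p^{n-1}})M_\sigma(T^{p^{n-2}})\cdots M_\sigma(T).$$
   Context: $\mathcal A_m=\{0,\dots,m-1\}$. For a word $W=w_0\cdots w_{r-1}$ over $\mathcal A_m$ and $j\in\mathcal A_m$, $\beta_{W,j}(T)=\sum_{l:\,w_{r-1-l}=j}T^l\in\mathbb{F}_p[T]$ (positions of $j$ in the reversed word; $0$ if $j$ does not occur). For a uniform morphism $\tau$ on $\mathcal A_m$, $M_\tau(T)$ is the $m\times m$ matrix over $\mathbb{F}_p[T]$ with $(i,j)$ entry $\beta_{\tau(i),j}(T)$. -}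

module Defs where

open import Data.Nat using (ℕ; zero; suc; _+_; _*_; _^_)
open import Data.Fin using (Fin; _≟_)
open import Data.List using (List; []; _∷_; map; reverse; concatMap; foldr; allFin; replicate; _++_; [_]; length)
open import Data.Product using (∃)
open import Relation.Binary.PropositionalEquality using (_≡_)
open import Relation.Nullary using (yes; no)

Word : ℕ → Set
Word m = List (Fin m)

Morphism : ℕ → Set
Morphism m = Fin m → Word m

IsUniform : ∀ {m} → ℕ → Morphism m → Set
IsUniform {m} k σ = (i : Fin m) → length (σ i) ≡ k

applyW : ∀ {m} → Morphism m → Word m → Word m
applyW σ = concatMap σ

_^[_] : ∀ {m} → Morphism m → ℕ → Morphism m
(σ ^[ zero ]) i = [ i ]
(σ ^[ suc n ]) i = applyW σ ((σ ^[ n ]) i)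

-- Polynomials over F_p: coefficient lists (constant term first) with
-- natural-number coefficients, compared coefficientwise modulo p.

Poly : Set
Poly = List ℕ

coeff : Poly → ℕ → ℕ
coeff [] _ = 0
coeff (c ∷ cs) zero = c
coeff (c ∷ cs) (suc i) = coeff cs i

_+P_ : Poly → Poly → Poly
[] +P q = q
(a ∷ as) +P [] = a ∷ as
(a ∷ as) +P (b ∷ bs) = (a + b) ∷ (as +P bs)

_*P_ : Poly → Poly → Poly
[] *P q = []
(a ∷ as) *P q = map (a *_) q +P (0 ∷ (as *P q))

monomial : ℕ → Poly
monomial k = replicate k 0 ++ [ 1 ]

-- P(T) ↦ P(T^k)  (Horner evaluation at T^k)
substPow : ℕ → Poly → Poly
substPow k = foldr (λ c acc → [ c ] +P (monomial k *P acc)) []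

_≡_[mod_] : ℕ → ℕ → ℕ → Set
a ≡ b [mod p ] = ∃ λ x → ∃ λ y → a + x * p ≡ b + y * p

PolyEq : ℕ → Poly → Poly → Set
PolyEq p P Q = (i : ℕ) → coeff P i ≡ coeff Q i [mod p ]

-- β_{W,j}(T) = Σ_{l : w_{r-1-l} = j} T^l : coefficient l is 1 iff the
-- l-th letter of the reversed word is j.
β : ∀ {m} → Word m → Fin m → Poly
β W j = map (λ w → indicator w) (reverse W)
  where
  indicator : _ → ℕ
  indicator w with w ≟ j
  ... | yes _ = 1
  ... | no  _ = 0

Mat : ℕ → Set
Mat m = Fin m → Fin m → Poly

MatEq : ∀ {m} → ℕ → Mat m → Mat m → Set
MatEq {m} p A B = (i j : Fin m) → PolyEq p (A i j) (B i j)

sumP : List Poly → Poly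
sumP = foldr _+P_ []

_·M_ : ∀ {m} → Mat m → Mat m → Mat m
_·M_ {m} A B i j = sumP (map (λ k → A i k *P B k j) (allFin m))

identityM : ∀ {m} → Mat m
identityM i j with i ≟ j
... | yes _ = [ 1 ]
... | no  _ = []

substM : ∀ {m} → ℕ → Mat m → Mat m
substM k A i j = substPow k (A i j)

M : ∀ {m} → Morphism m → Mat m
M τ i j = β (τ i) j

prodM : ∀ {m} → ℕ → Morphism m → ℕ → Mat m
prodM p σ zero = identityM
prodM p σ (suc n) = substM (p ^ n) (M σ) ·M prodM p σ n

-- For a k-uniform morphism τ and any word W, the row vector (β_{τ(W),j})_j equals
-- (β_{W,i}(T^k))_i · M_τ(T): a letter i of W followed by r further letters contributes
-- the i-th row of M_τ(T), pushed up by T^(k r) since the r images after τ(i) have length k each.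
-- As σ^(n+1)(i) = σ^n(σ(i)) and σ^n is p^n-uniform, this gives
-- M_{σ^(n+1)}(T) = M_σ(T^(p^n)) M_{σ^n}(T), and induction on n concludes.  The identity
-- holds exactly with natural coefficients, so neither primality of p nor m, n ≥ 1 is needed.
module Submission where

open import Defs
open import Data.Nat using (ℕ; zero; suc; _+_; _*_; _^_; _≤_)
open import Data.Nat.Properties
  using (+-identityʳ; +-comm; +-assoc; *-identityˡ; *-zeroʳ; *-suc; *-distribʳ-+; +-commutativeSemigroup)
open import Data.Nat.Primality using (Prime)
open import Data.Fin using (Fin; _≟_) renaming (zero to fzero; suc to fsuc)
open import Data.Bool using (if_then_else_)
open import Data.List
  using ([]; _∷_; map; reverse; allFin; replicate; tabulate; _++_; [_]; length)
open import Data.List.Properties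
  using (map-++; reverse-++; length-map; length-reverse; length-++; map-tabulate)
open import Data.List.Effectful using (module MonadProperties)
open import Data.Product using (_,_)
open import Function using (_∘_)
open import Algebra.Bundles using (CommutativeMonoid)
open import Algebra.Properties.CommutativeSemigroup +-commutativeSemigroup using (interchange)
open import Level using (0ℓ)
open import Relation.Binary.Bundles using (Setoid)
open import Relation.Binary.Structures using (IsEquivalence)
open import Relation.Binary.PropositionalEquality
  using (_≡_; refl; sym; trans; cong; cong₂; module ≡-Reasoning)
open import Relation.Nullary using (does; yes; no)
import Relation.Binary.Reasoning.Setoid as SetoidReasoning

infix 4 _≈_

-- A record rather than a function type, so that the polynomials can be inferred from a proof.
record _≈_ (P Q : Poly) : Set where
  constructor coeffwise
  field coeff-≡ : ∀ i → coeff P i ≡ coeff Q i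

open _≈_

≈-isEquivalence : IsEquivalence _≈_
≈-isEquivalence = record
  { refl  = coeffwise λ _ → refl
  ; sym   = λ e → coeffwise λ i → sym (coeff-≡ e i)
  ; trans = λ e f → coeffwise λ i → trans (coeff-≡ e i) (coeff-≡ f i)
  }

≈-setoid : Setoid 0ℓ 0ℓ
≈-setoid = record { isEquivalence = ≈-isEquivalence }

open Setoid ≈-setoid using () renaming (refl to ≈-refl; reflexive to ≈-reflexive; sym to ≈-sym; trans to ≈-trans)

module ≈-Reasoning = SetoidReasoning ≈-setoid

coeff-+P : ∀ P Q i → coeff (P +P Q) i ≡ coeff P i + coeff Q i
coeff-+P []      Q       i       = refl
coeff-+P (a ∷ P) []      i       = sym (+-identityʳ _)
coeff-+P (a ∷ P) (b ∷ Q) zero    = refl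
coeff-+P (a ∷ P) (b ∷ Q) (suc i) = coeff-+P P Q i

+P-cong : ∀ {P P′ Q Q′} → P ≈ P′ → Q ≈ Q′ → P +P Q ≈ P′ +P Q′
+P-cong {P} {P′} {Q} {Q′} e f = coeffwise λ i → begin
  coeff (P +P Q) i       ≡⟨ coeff-+P P Q i ⟩
  coeff P i + coeff Q i   ≡⟨ cong₂ _+_ (coeff-≡ e i) (coeff-≡ f i) ⟩
  coeff P′ i + coeff Q′ i ≡⟨ coeff-+P P′ Q′ i ⟨
  coeff (P′ +P Q′) i     ∎
  where open ≡-Reasoning

+P-congˡ : ∀ P {Q Q′} → Q ≈ Q′ → P +P Q ≈ P +P Q′
+P-congˡ P = +P-cong ≈-refl

+P-congʳ : ∀ {P P′} Q → P ≈ P′ → P +P Q ≈ P′ +P Q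
+P-congʳ Q e = +P-cong e ≈-refl

+P-assoc : ∀ P Q R → (P +P Q) +P R ≈ P +P (Q +P R)
+P-assoc P Q R = coeffwise λ i → begin
  coeff ((P +P Q) +P R) i               ≡⟨ coeff-+P (P +P Q) R i ⟩
  coeff (P +P Q) i + coeff R i          ≡⟨ cong (_+ coeff R i) (coeff-+P P Q i) ⟩
  (coeff P i + coeff Q i) + coeff R i   ≡⟨ +-assoc (coeff P i) (coeff Q i) (coeff R i) ⟩
  coeff P i + (coeff Q i + coeff R i)   ≡⟨ cong (coeff P i +_) (coeff-+P Q R i) ⟨
  coeff P i + coeff (Q +P R) i          ≡⟨ coeff-+P P (Q +P R) i ⟨
  coeff (P +P (Q +P R)) i               ∎
  where open ≡-Reasoning

+P-comm : ∀ P Q → P +P Q ≈ Q +P P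
+P-comm P Q = coeffwise λ i → trans (coeff-+P P Q i) (trans (+-comm (coeff P i) (coeff Q i)) (sym (coeff-+P Q P i)))

+P-identityˡ : ∀ P → [] +P P ≈ P
+P-identityˡ P = ≈-refl

+P-identityʳ : ∀ P → P +P [] ≈ P
+P-identityʳ P = coeffwise λ i → trans (coeff-+P P [] i) (+-identityʳ (coeff P i))

+P-commutativeMonoid : CommutativeMonoid 0ℓ 0ℓ
+P-commutativeMonoid = record
  { Carrier = Poly
  ; _≈_ = _≈_
  ; _∙_ = _+P_
  ; ε = []
  ; isCommutativeMonoid = record
    { isMonoid = record
      { isSemigroup = record
        { isMagma = record { isEquivalence = ≈-isEquivalence ; ∙-cong = +P-cong }
        ; assoc = +P-assoc
        }
      ; identity = +P-identityˡ , +P-identityʳ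
      }
    ; comm = +P-comm
    }
  }

open import Algebra.Properties.CommutativeMonoid.Sum +P-commutativeMonoid
  using (sum; sum-syntax; ∑-distrib-+; sum-cong-≋; sum-replicate-zero)

∷-congʳ : ∀ {a P Q} → P ≈ Q → a ∷ P ≈ a ∷ Q
∷-congʳ e = coeffwise λ where
  zero    → refl
  (suc i) → coeff-≡ e i

[0]≈[] : [ 0 ] ≈ []
[0]≈[] = coeffwise λ where
  zero    → refl
  (suc i) → refl

shift : ℕ → Poly → Poly
shift n P = replicate n 0 ++ P

shift-+ : ∀ m n P → shift (m + n) P ≡ shift m (shift n P)
shift-+ zero    n P = refl
shift-+ (suc m) n P = cong (0 ∷_) (shift-+ m n P)

shift-cong : ∀ n {P Q} → P ≈ Q → shift n P ≈ shift n Q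
shift-cong zero    e = e
shift-cong (suc n) e = ∷-congʳ (shift-cong n e)

shift-[] : ∀ n → shift n [] ≈ []
shift-[] zero    = ≈-refl
shift-[] (suc n) = ≈-trans (∷-congʳ (shift-[] n)) [0]≈[]

shift-+P : ∀ n P Q → shift n (P +P Q) ≈ shift n P +P shift n Q
shift-+P zero    P Q = ≈-refl
shift-+P (suc n) P Q = ∷-congʳ (shift-+P n P Q)

++≈+P-shift : ∀ A B → A ++ B ≈ A +P shift (length A) B
++≈+P-shift []      B = ≈-refl
++≈+P-shift (a ∷ A) B = coeffwise λ where
  zero    → sym (+-identityʳ a)
  (suc i) → coeff-≡ (++≈+P-shift A B) i

coeff-map-* : ∀ a Q i → coeff (map (a *_) Q) i ≡ a * coeff Q i
coeff-map-* a []      i       = sym (*-zeroʳ a)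
coeff-map-* a (b ∷ Q) zero    = refl
coeff-map-* a (b ∷ Q) (suc i) = coeff-map-* a Q i

coeff-∷-*P : ∀ a P Q i → coeff ((a ∷ P) *P Q) i ≡ a * coeff Q i + coeff (0 ∷ (P *P Q)) i
coeff-∷-*P a P Q i =
  trans (coeff-+P (map (a *_) Q) (0 ∷ (P *P Q)) i) (cong (_+ _) (coeff-map-* a Q i))

*P-zeroˡ : ∀ P Q → P ≈ [] → P *P Q ≈ []
*P-zeroˡ []      Q e = ≈-refl
*P-zeroˡ (a ∷ P) Q e = coeffwise λ i →
  trans (coeff-∷-*P a P Q i) (cong₂ _+_ (cong (_* coeff Q i) (coeff-≡ e zero)) (coeff-≡ tail≈[] i))
  where
  tail≈[] : 0 ∷ (P *P Q) ≈ []
  tail≈[] = ≈-trans (∷-congʳ (*P-zeroˡ P Q (coeffwise (coeff-≡ e ∘ suc)))) [0]≈[]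

*P-zeroʳ : ∀ P → P *P [] ≈ []
*P-zeroʳ []      = ≈-refl
*P-zeroʳ (a ∷ P) = ≈-trans (∷-congʳ (*P-zeroʳ P)) [0]≈[]

*P-identityˡ : ∀ Q → [ 1 ] *P Q ≈ Q
*P-identityˡ Q = coeffwise λ i → begin
  coeff ([ 1 ] *P Q) i                       ≡⟨ coeff-∷-*P 1 [] Q i ⟩
  1 * coeff Q i + coeff (0 ∷ ([] *P Q)) i    ≡⟨ cong (1 * coeff Q i +_) (coeff-≡ [0]≈[] i) ⟩
  1 * coeff Q i + 0                          ≡⟨ +-identityʳ _ ⟩
  1 * coeff Q i                              ≡⟨ *-identityˡ _ ⟩
  coeff Q i                                  ∎
  where open ≡-Reasoning

*P-congˡ : ∀ P P′ Q → P ≈ P′ → P *P Q ≈ P′ *P Q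
*P-congˡ []      []        Q e = ≈-refl
*P-congˡ []      (b ∷ P′) Q e = ≈-sym (*P-zeroˡ (b ∷ P′) Q (≈-sym e))
*P-congˡ (a ∷ P) []        Q e = *P-zeroˡ (a ∷ P) Q e
*P-congˡ (a ∷ P) (b ∷ P′) Q e = coeffwise λ i → begin
  coeff ((a ∷ P) *P Q) i                    ≡⟨ coeff-∷-*P a P Q i ⟩
  a * coeff Q i + coeff (0 ∷ (P *P Q)) i    ≡⟨ cong₂ _+_ (cong (_* coeff Q i) (coeff-≡ e zero)) (coeff-≡ tails i) ⟩
  b * coeff Q i + coeff (0 ∷ (P′ *P Q)) i   ≡⟨ coeff-∷-*P b P′ Q i ⟨
  coeff ((b ∷ P′) *P Q) i                   ∎
  where
  open ≡-Reasoning
  tails : 0 ∷ (P *P Q) ≈ 0 ∷ (P′ *P Q)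
  tails = ∷-congʳ (*P-congˡ P P′ Q (coeffwise (coeff-≡ e ∘ suc)))

*P-congʳ : ∀ P Q Q′ → Q ≈ Q′ → P *P Q ≈ P *P Q′
*P-congʳ []      Q Q′ e = ≈-refl
*P-congʳ (a ∷ P) Q Q′ e = coeffwise λ i → begin
  coeff ((a ∷ P) *P Q) i                    ≡⟨ coeff-∷-*P a P Q i ⟩
  a * coeff Q i + coeff (0 ∷ (P *P Q)) i    ≡⟨ cong₂ _+_ (cong (a *_) (coeff-≡ e i)) (coeff-≡ (∷-congʳ (*P-congʳ P Q Q′ e)) i) ⟩
  a * coeff Q′ i + coeff (0 ∷ (P *P Q′)) i  ≡⟨ coeff-∷-*P a P Q′ i ⟨
  coeff ((a ∷ P) *P Q′) i                   ∎
  where open ≡-Reasoning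

*P-distribʳ : ∀ P P′ Q → (P +P P′) *P Q ≈ (P *P Q) +P (P′ *P Q)
*P-distribʳ []      P′        Q = ≈-refl
*P-distribʳ (a ∷ P) []        Q = ≈-sym (+P-identityʳ ((a ∷ P) *P Q))
*P-distribʳ (a ∷ P) (b ∷ P′) Q = coeffwise λ i → begin
  coeff (((a + b) ∷ (P +P P′)) *P Q) i
    ≡⟨ coeff-∷-*P (a + b) (P +P P′) Q i ⟩
  (a + b) * coeff Q i + coeff (0 ∷ ((P +P P′) *P Q)) i
    ≡⟨ cong₂ _+_ (*-distribʳ-+ (coeff Q i) a b) (trans (coeff-≡ tails i) (coeff-+P (0 ∷ (P *P Q)) (0 ∷ (P′ *P Q)) i)) ⟩
  (a * coeff Q i + b * coeff Q i) + (coeff (0 ∷ (P *P Q)) i + coeff (0 ∷ (P′ *P Q)) i)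
    ≡⟨ interchange (a * coeff Q i) (b * coeff Q i) _ _ ⟩
  (a * coeff Q i + coeff (0 ∷ (P *P Q)) i) + (b * coeff Q i + coeff (0 ∷ (P′ *P Q)) i)
    ≡⟨ cong₂ _+_ (coeff-∷-*P a P Q i) (coeff-∷-*P b P′ Q i) ⟨
  coeff ((a ∷ P) *P Q) i + coeff ((b ∷ P′) *P Q) i
    ≡⟨ coeff-+P ((a ∷ P) *P Q) ((b ∷ P′) *P Q) i ⟨
  coeff (((a ∷ P) *P Q) +P ((b ∷ P′) *P Q)) i
    ∎
  where
  open ≡-Reasoning
  tails : 0 ∷ ((P +P P′) *P Q) ≈ (0 ∷ (P *P Q)) +P (0 ∷ (P′ *P Q))
  tails = ∷-congʳ (*P-distribʳ P P′ Q)

shift-*P : ∀ n P Q → shift n P *P Q ≈ shift n (P *P Q)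
shift-*P zero    P Q = ≈-refl
shift-*P (suc n) P Q = coeffwise λ i →
  trans (coeff-∷-*P 0 (shift n P) Q i) (coeff-≡ (∷-congʳ (shift-*P n P Q)) i)

monomial-*P : ∀ k Q → monomial k *P Q ≈ shift k Q
monomial-*P k Q = ≈-trans (shift-*P k [ 1 ] Q) (shift-cong k (*P-identityˡ Q))

substPow-++ : ∀ k A B → substPow k (A ++ B) ≈ substPow k A +P shift (k * length A) (substPow k B)
substPow-++ k []      B = ≈-reflexive (cong (λ n → shift n (substPow k B)) (sym (*-zeroʳ k)))
substPow-++ k (a ∷ A) B = begin
  [ a ] +P (monomial k *P substPow k (A ++ B))         ≈⟨ +P-congˡ [ a ] (monomial-*P k (substPow k (A ++ B))) ⟩
  [ a ] +P shift k (substPow k (A ++ B))              ≈⟨ +P-congˡ [ a ] (shift-cong k (substPow-++ k A B)) ⟩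
  [ a ] +P shift k (sA +P shift (k * length A) sB)    ≈⟨ +P-congˡ [ a ] (shift-+P k sA (shift (k * length A) sB)) ⟩
  [ a ] +P (shift k sA +P shift k (shift (k * length A) sB))
                                                       ≈⟨ +P-assoc [ a ] (shift k sA) (shift k (shift (k * length A) sB)) ⟨
  ([ a ] +P shift k sA) +P shift k (shift (k * length A) sB)
                                                       ≈⟨ +P-cong (+P-congˡ [ a ] (monomial-*P k sA)) (≈-reflexive shifts) ⟨
  ([ a ] +P (monomial k *P sA)) +P shift (k * suc (length A)) sB ∎
  where
  open ≈-Reasoning
  sA sB : Poly
  sA = substPow k A
  sB = substPow k B
  shifts : shift (k * suc (length A)) sB ≡ shift k (shift (k * length A) sB)
  shifts = trans (cong (λ n → shift n sB) (*-suc k (length A))) (shift-+ k (k * length A) sB)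

substPow-singleton : ∀ k c → substPow k [ c ] ≈ [ c ]
substPow-singleton k c = ≈-trans (+P-congˡ [ c ] (*P-zeroʳ (monomial k))) (+P-identityʳ [ c ])

sumP-tabulate : ∀ {m} (f : Fin m → Poly) → sumP (tabulate f) ≡ sum f
sumP-tabulate {zero}  f = refl
sumP-tabulate {suc m} f = cong (f fzero +P_) (sumP-tabulate (f ∘ fsuc))

sumP-allFin : ∀ m (f : Fin m → Poly) → sumP (map f (allFin m)) ≡ ∑[ k < m ] f k
sumP-allFin m f = trans (cong sumP (map-tabulate (λ k → k) f)) (sumP-tabulate f)

shift-∑ : ∀ n {m} (f : Fin m → Poly) → shift n (∑[ k < m ] f k) ≈ ∑[ k < m ] shift n (f k)
shift-∑ n {zero}  f = shift-[] n
shift-∑ n {suc m} f = ≈-trans (shift-+P n (f fzero) (sum (f ∘ fsuc))) (+P-congˡ (shift n (f fzero)) (shift-∑ n (f ∘ fsuc)))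

-- Unlike the indicator inside β, this reduces: δ (fsuc i) (fsuc j) is δ i j by definition.
δ : ∀ {m} → Fin m → Fin m → ℕ
δ i j = if does (i ≟ j) then 1 else 0

∑-zero : ∀ {m} (f : Fin m → Poly) → (∀ k → f k ≈ []) → ∑[ k < m ] f k ≈ []
∑-zero {m} f e = ≈-trans (sum-cong-≋ {x = f} {y = λ _ → []} e) (sum-replicate-zero m)

∑-δ : ∀ {m} (i : Fin m) (f : Fin m → Poly) → ∑[ k < m ] ([ δ i k ] *P f k) ≈ f i
∑-δ {suc m} fzero f = begin
  ([ 1 ] *P f fzero) +P (∑[ k < m ] ([ 0 ] *P f (fsuc k)))  ≈⟨ +P-cong (*P-identityˡ (f fzero)) (∑-zero (λ k → [ 0 ] *P f (fsuc k)) λ k → *P-zeroˡ [ 0 ] (f (fsuc k)) [0]≈[]) ⟩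
  f fzero +P []                                              ≈⟨ +P-identityʳ (f fzero) ⟩
  f fzero                                                    ∎
  where open ≈-Reasoning
∑-δ {suc m} (fsuc i) f =
  ≈-trans (+P-congʳ (∑[ k < m ] ([ δ i k ] *P f (fsuc k))) (*P-zeroˡ [ 0 ] (f fzero) [0]≈[])) (∑-δ i (f ∘ fsuc))

β-++ : ∀ {m} (U V : Word m) j → β (U ++ V) j ≡ β V j ++ β U j
β-++ U V j = trans (cong (map _) (reverse-++ U V)) (map-++ _ (reverse V) (reverse U))

β-length : ∀ {m} (W : Word m) j → length (β W j) ≡ length W
β-length W j = trans (length-map _ (reverse W)) (length-reverse W)

β-singleton : ∀ {m} (w j : Fin m) → β [ w ] j ≡ [ δ w j ]
β-singleton w j with w ≟ j
... | yes _ = refl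
... | no  _ = refl

β-∷ : ∀ {m} (w : Fin m) W j → β (w ∷ W) j ≡ β W j ++ [ δ w j ]
β-∷ w W j = trans (β-++ [ w ] W j) (cong (β W j ++_) (β-singleton w j))

applyW-length : ∀ {m k} (τ : Morphism m) → IsUniform k τ → ∀ W → length (applyW τ W) ≡ k * length W
applyW-length {k = k} τ τ-uniform []      = sym (*-zeroʳ k)
applyW-length {k = k} τ τ-uniform (w ∷ W) = begin
  length (τ w ++ applyW τ W)             ≡⟨ length-++ (τ w) ⟩
  length (τ w) + length (applyW τ W)     ≡⟨ cong₂ _+_ (τ-uniform w) (applyW-length τ τ-uniform W) ⟩
  k + k * length W                       ≡⟨ *-suc k (length W) ⟨
  k * suc (length W)                     ∎
  where open ≡-Reasoning

substPow-β-∷ : ∀ {m} k (w : Fin m) W j →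
  substPow k (β (w ∷ W) j) ≈ substPow k (β W j) +P shift (k * length W) [ δ w j ]
substPow-β-∷ k w W j = begin
  substPow k (β (w ∷ W) j)                                               ≡⟨ cong (substPow k) (β-∷ w W j) ⟩
  substPow k (β W j ++ [ δ w j ])                                        ≈⟨ substPow-++ k (β W j) [ δ w j ] ⟩
  substPow k (β W j) +P shift (k * length (β W j)) (substPow k [ δ w j ]) ≈⟨ +P-congˡ (substPow k (β W j)) (shift-cong _ (substPow-singleton k (δ w j))) ⟩
  substPow k (β W j) +P shift (k * length (β W j)) [ δ w j ]              ≡⟨ cong (λ n → substPow k (β W j) +P shift (k * n) [ δ w j ]) (β-length W j) ⟩
  substPow k (β W j) +P shift (k * length W) [ δ w j ]                    ∎
  where open ≈-Reasoning

β-applyW : ∀ {m k} (τ : Morphism m) → IsUniform k τ → ∀ W j →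
  β (applyW τ W) j ≈ ∑[ i < m ] (substPow k (β W i) *P M τ i j)
β-applyW {m}     τ τ-uniform []      j = ≈-sym (∑-zero {m} (λ _ → []) (λ _ → ≈-refl))
β-applyW {m} {k} τ τ-uniform (w ∷ W) j = begin
  β (τ w ++ τW) j
    ≡⟨ β-++ (τ w) τW j ⟩
  β τW j ++ M τ w j
    ≈⟨ ++≈+P-shift (β τW j) (M τ w j) ⟩
  β τW j +P shift (length (β τW j)) (M τ w j)
    ≡⟨ cong (λ n → β τW j +P shift n (M τ w j)) (trans (β-length τW j) (applyW-length τ τ-uniform W)) ⟩
  β τW j +P shift N (M τ w j)
    ≈⟨ +P-cong (β-applyW τ τ-uniform W j) (shift-cong N (≈-sym (∑-δ w (λ i → M τ i j)))) ⟩
  (∑[ i < m ] old i) +P shift N (∑[ i < m ] ([ δ w i ] *P M τ i j))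
    ≈⟨ +P-congˡ (∑[ i < m ] old i) (shift-∑ N (λ i → [ δ w i ] *P M τ i j)) ⟩
  (∑[ i < m ] old i) +P (∑[ i < m ] new i)
    ≈⟨ ∑-distrib-+ old new ⟨
  ∑[ i < m ] (old i +P new i)
    ≈⟨ sum-cong-≋ {x = λ i → old i +P new i} {y = λ i → substPow k (β (w ∷ W) i) *P M τ i j} (≈-sym ∘ term) ⟩
  ∑[ i < m ] (substPow k (β (w ∷ W) i) *P M τ i j)
    ∎
  where
  open ≈-Reasoning
  τW : Word _
  τW = applyW τ W
  N : ℕ
  N = k * length W
  old new : Fin m → Poly
  old i = substPow k (β W i) *P M τ i j
  new i = shift N ([ δ w i ] *P M τ i j)
  term : ∀ i → substPow k (β (w ∷ W) i) *P M τ i j ≈ old i +P new i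
  term i = begin
    substPow k (β (w ∷ W) i) *P M τ i j
      ≈⟨ *P-congˡ _ _ (M τ i j) (substPow-β-∷ k w W i) ⟩
    (substPow k (β W i) +P shift N [ δ w i ]) *P M τ i j
      ≈⟨ *P-distribʳ (substPow k (β W i)) (shift N [ δ w i ]) (M τ i j) ⟩
    old i +P (shift N [ δ w i ] *P M τ i j)
      ≈⟨ +P-congˡ (old i) (shift-*P N [ δ w i ] (M τ i j)) ⟩
    old i +P new i
      ∎

applyW-applyW : ∀ {m} (σ τ : Morphism m) W → applyW σ (applyW τ W) ≡ applyW (applyW σ ∘ τ) W
applyW-applyW σ τ W = sym (MonadProperties.associative W τ σ)

^[]-suc : ∀ {m} (σ : Morphism m) n i → (σ ^[ suc n ]) i ≡ applyW (σ ^[ n ]) (σ i)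
^[]-suc σ zero    i = trans (MonadProperties.left-identity i σ) (sym (MonadProperties.right-identity (σ i)))
^[]-suc σ (suc n) i = trans (cong (applyW σ) (^[]-suc σ n i)) (applyW-applyW σ (σ ^[ n ]) (σ i))

^[]-uniform : ∀ {m k} (σ : Morphism m) → IsUniform k σ → ∀ n → IsUniform (k ^ n) (σ ^[ n ])
^[]-uniform         σ σ-uniform zero    i = refl
^[]-uniform {k = k} σ σ-uniform (suc n) i =
  trans (applyW-length σ σ-uniform ((σ ^[ n ]) i)) (cong (k *_) (^[]-uniform σ σ-uniform n i))

β-singleton≈identityM : ∀ {m} (i j : Fin m) → β [ i ] j ≈ identityM i j
β-singleton≈identityM i j with i ≟ j
... | yes _ = ≈-refl
... | no  _ = [0]≈[]

M-^[] : ∀ {m} p (σ : Morphism m) → IsUniform p σ → ∀ n i j → M (σ ^[ n ]) i j ≈ prodM p σ n i j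
M-^[]     p σ σ-uniform zero    i j = β-singleton≈identityM i j
M-^[] {m} p σ σ-uniform (suc n) i j = begin
  β ((σ ^[ suc n ]) i) j
    ≡⟨ cong (λ W → β W j) (^[]-suc σ n i) ⟩
  β (applyW (σ ^[ n ]) (σ i)) j
    ≈⟨ β-applyW (σ ^[ n ]) (^[]-uniform σ σ-uniform n) (σ i) j ⟩
  ∑[ k < m ] (substPow (p ^ n) (M σ i k) *P M (σ ^[ n ]) k j)
    ≈⟨ sum-cong-≋ (λ k → *P-congʳ (substPow (p ^ n) (M σ i k)) _ _ (M-^[] p σ σ-uniform n k j)) ⟩
  ∑[ k < m ] (substPow (p ^ n) (M σ i k) *P prodM p σ n k j)
    ≡⟨ sumP-allFin m (λ k → substPow (p ^ n) (M σ i k) *P prodM p σ n k j) ⟨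
  prodM p σ (suc n) i j
    ∎
  where open ≈-Reasoning

≈⇒PolyEq : ∀ p {P Q} → P ≈ Q → PolyEq p P Q
≈⇒PolyEq p e i = 0 , 0 , cong (_+ 0) (coeff-≡ e i)

corollary4p12 : (p : ℕ) → Prime p → (m : ℕ) → 1 ≤ m → (σ : Morphism m) → IsUniform p σ →
    (n : ℕ) → 1 ≤ n → MatEq p (M (σ ^[ n ])) (prodM p σ n)
corollary4p12 p _ m _ σ σ-uniform n _ i j = ≈⇒PolyEq p (M-^[] p σ σ-uniform n i j)
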